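{- Let $A$ be a linear order and $u\in A^{\omega^*}$, and consider the class $[u]_\infty$ with its lexicographic order. (1) If $A$ has no endpoints, $[u]_\infty$ is a $\mathbb{Z}$-order. (2) If $A$ has a left endpoint but no right endpoint, $[u]_\infty$ is either an $\omega$-order or a $\mathbb{Z}$-order. (3) If $A$ has a right endpoint but no left endpoint, $[u]_\infty$ is either an $\omega^*$-order or a $\mathbb{Z}$-order.
   Context: $A^{\omega^*}$ is the set of left-infinite sequences $u=(\ldots,u_2,u_1,u_0)$ with $u_i\in A$. Two such sequences are eventually equal, $u\sim_\infty v$, if there is $N$ with $u_n=v_n$ for all $n>N$; $[u]_\infty$ denotes the $\sim_\infty$-class of $u$. This class is linearly ordered lexicographically: for $u\neq v$ in the same class, $u<v$ iff $u_N<v_N$ where $N$ is the largest index with $u_N\neq v_N$. A $\mathbb{Z}$-order has no endpoints and has coinitiality and cofinality $\omega$; an $\omega$-order has a minimum and cofinality $\omega$; an $\omega^*$-order has a maximum and coinitiality $\omega$. -}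

module Defs where

open import Level using (Level; _⊔_)
open import Data.Nat using (ℕ; suc) renaming (_<_ to _<ℕ_)
open import Data.Product using (Σ; ∃; ∃-syntax; _×_; proj₁)
open import Data.Sum using (_⊎_)
open import Relation.Nullary using (¬_)
open import Relation.Binary.Bundles using (StrictTotalOrder)

module OrderNotions {x r e : Level} (X : Set x)
                    (_<_ : X → X → Set r) (_≈_ : X → X → Set e) where

  _≤_ : X → X → Set (r ⊔ e)
  a ≤ b = a < b ⊎ a ≈ b

  HasMin : Set (x ⊔ r ⊔ e)
  HasMin = ∃[ m ] (∀ a → m ≤ a)

  HasMax : Set (x ⊔ r ⊔ e)
  HasMax = ∃[ m ] (∀ a → a ≤ m)

  -- no left / right endpoint (constructive, positive reading)
  NoMin : Set (x ⊔ r)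
  NoMin = ∀ a → ∃[ b ] (b < a)

  NoMax : Set (x ⊔ r)
  NoMax = ∀ a → ∃[ b ] (a < b)

  CofinalityΩ : Set (x ⊔ r ⊔ e)
  CofinalityΩ = Σ (ℕ → X) λ c → (∀ n → c n < c (suc n)) × (∀ a → ∃[ n ] (a ≤ c n))

  CoinitialityΩ : Set (x ⊔ r ⊔ e)
  CoinitialityΩ = Σ (ℕ → X) λ c → (∀ n → c (suc n) < c n) × (∀ a → ∃[ n ] (c n ≤ a))

  ZOrder : Set (x ⊔ r ⊔ e)
  ZOrder = NoMin × NoMax × CoinitialityΩ × CofinalityΩ

  ωOrder : Set (x ⊔ r ⊔ e)
  ωOrder = HasMin × CofinalityΩ

  ω*Order : Set (x ⊔ r ⊔ e)
  ω*Order = HasMax × CoinitialityΩ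

-- Left-infinite sequences (…, u 2, u 1, u 0) over a linear order A,
-- eventual equality, the class [u]∞ and its lexicographic order.
module LeftInfinite {a ℓ₁ ℓ₂ : Level} (A : StrictTotalOrder a ℓ₁ ℓ₂) where
  open StrictTotalOrder A renaming (Carrier to Aᶜ)

  Seq : Set a
  Seq = ℕ → Aᶜ

  _∼∞_ : Seq → Seq → Set ℓ₁
  u ∼∞ v = ∃[ N ] (∀ n → N <ℕ n → u n ≈ v n)

  Class : Seq → Set (a ⊔ ℓ₁)
  Class u = Σ Seq λ v → v ∼∞ u

  module _ {u : Seq} where
    _≈L_ : Class u → Class u → Set ℓ₁
    p ≈L q = ∀ n → proj₁ p n ≈ proj₁ q n

    _<L_ : Class u → Class u → Set (ℓ₁ ⊔ ℓ₂)
    p <L q = ∃[ N ] (proj₁ p N < proj₁ q N × (∀ n → N <ℕ n → proj₁ p n ≈ proj₁ q n))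

  module OnA = OrderNotions Aᶜ _<_ _≈_

  module OnClass (u : Seq) = OrderNotions (Class u) (_<L_ {u}) (_≈L_ {u})

-- Every element of [u]∞ agrees with u beyond some index, so changing u at one
-- index k beyond that bound of p gives an element above p when the new letter
-- exceeds u k, and below p when it is smaller.  If u k can be raised for
-- infinitely many k, raising it along a strictly increasing sequence of such
-- indices yields a strictly increasing cofinal chain, and no element is
-- maximal; lowering is the same argument for the reversed order of A.  Without
-- endpoints in A every letter moves both ways, giving a ℤ-order.  If A has a
-- minimum m, either u is eventually m, and then the constant sequence m is the
-- least element (the lexicographic order is total on the class), or u k > m for
-- infinitely many k and the chain argument applies.  This case distinction is
-- the only classical step; (3) is (2) for the reversed order.
module Submission where

open import Defs
open import Level using (_⊔_; Lift; lift; lower)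
open import Function using (id)
open import Data.Product using (_×_; _,_; proj₁; proj₂; ∃-syntax; map₂)
import Data.Product as Product
open import Data.Sum using (_⊎_; inj₁; inj₂)
import Data.Sum as Sum
open import Data.Empty using (⊥-elim)
open import Data.Nat using (ℕ; zero; suc; z≤n)
  renaming (_<_ to _<ℕ_; _≤_ to _≤ℕ_; _⊔_ to _⊔ℕ_; _≟_ to _≟ℕ_)
open import Data.Nat.Properties
  using (n<1+n; <-trans; ≤-<-trans; >⇒≢; m≤n⇒m<n∨m≡n; m⊔n<o⇒m<o; m⊔n<o⇒n<o)
open import Axiom.ExcludedMiddle using (ExcludedMiddle)
open import Relation.Binary.Bundles using (StrictTotalOrder)
open import Relation.Binary.Definitions using (tri<; tri≈; tri>)
open import Relation.Binary.PropositionalEquality using (refl)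
open import Relation.Nullary using (¬_; yes; no)
open import Relation.Nullary.Decidable using (map′; decidable-stable)
import Relation.Binary.Construct.Flip.EqAndOrd as Flip

Eventually : ∀ {p} → (ℕ → Set p) → Set p
Eventually P = ∃[ K ] (∀ n → K <ℕ n → P n)

InfinitelyOften : ∀ {p} → (ℕ → Set p) → Set p
InfinitelyOften P = ∀ K → ∃[ n ] (K <ℕ n × P n)

infinitelyOften-map : ∀ {p q} {P : ℕ → Set p} {Q : ℕ → Set q} →
                      (∀ {n} → P n → Q n) → InfinitelyOften P → InfinitelyOften Q
infinitelyOften-map f io K = map₂ (map₂ f) (io K)

everywhere⇒infinitelyOften : ∀ {p} {P : ℕ → Set p} → (∀ n → P n) → InfinitelyOften P
everywhere⇒infinitelyOften P-all K = suc K , n<1+n K , P-all (suc K)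

excludedMiddle-lower : ∀ ℓ {p} → ExcludedMiddle (ℓ ⊔ p) → ExcludedMiddle p
excludedMiddle-lower ℓ em {P} = map′ lower lift (em {Lift ℓ P})

¬eventually⇒infinitelyOften¬ : ∀ {p} {P : ℕ → Set p} → ExcludedMiddle p →
                               ¬ Eventually P → InfinitelyOften (λ n → ¬ P n)
¬eventually⇒infinitelyOften¬ {P = P} em ¬ev K with em {∃[ n ] (K <ℕ n × ¬ P n)}
... | yes witness = witness
... | no none = ⊥-elim (¬ev (K , λ n K<n → decidable-stable em (λ ¬Pn → none (n , K<n , ¬Pn))))

module Lexicographic {a ℓ₁ ℓ₂} (A : StrictTotalOrder a ℓ₁ ℓ₂) (u : LeftInfinite.Seq A) where
  open StrictTotalOrder A renaming (Carrier to Aᶜ)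
  open LeftInfinite A
  open OnClass u

  _<ˡ_ : Seq → Seq → Set (ℓ₁ ⊔ ℓ₂)
  v <ˡ w = ∃[ N ] (v N < w N × (∀ n → N <ℕ n → v n ≈ w n))

  compare-agreeing : ∀ B (v w : Seq) → (∀ j → B ≤ℕ j → v j ≈ w j) →
                     v <ˡ w ⊎ (∀ j → v j ≈ w j) ⊎ w <ˡ v
  compare-agreeing zero v w agree = inj₂ (inj₁ (λ j → agree j z≤n))
  compare-agreeing (suc B) v w agree with compare (v B) (w B)
  ... | tri< vB<wB _ _ = inj₁ (B , vB<wB , agree)
  ... | tri> _ _ wB<vB = inj₂ (inj₂ (B , wB<vB , λ n B<n → Eq.sym (agree n B<n)))
  ... | tri≈ _ vB≈wB _ = compare-agreeing B v w agree′
    where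
    agree′ : ∀ j → B ≤ℕ j → v j ≈ w j
    agree′ j B≤j with m≤n⇒m<n∨m≡n B≤j
    ... | inj₁ B<j = agree j B<j
    ... | inj₂ refl = vB≈wB

  compareˡ : ∀ (p q : Class u) → p <L q ⊎ p ≈L q ⊎ q <L p
  compareˡ (v , M , v∼u) (w , N , w∼u) =
    compare-agreeing (suc (M ⊔ℕ N)) v w λ j M⊔N<j →
      Eq.trans (v∼u j (m⊔n<o⇒m<o M N M⊔N<j)) (Eq.sym (w∼u j (m⊔n<o⇒n<o M N M⊔N<j)))

  constant-minimum : ∀ {m} → (∀ x → m < x ⊎ m ≈ x) →
                     (p : Class u) → (∀ n → proj₁ p n ≈ m) → ∀ q → p ≤ q
  constant-minimum {m} m-min p p≈m q with compareˡ p q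
  ... | inj₁ p<q = inj₁ p<q
  ... | inj₂ (inj₁ p≈q) = inj₂ p≈q
  ... | inj₂ (inj₂ (N , qN<pN , _)) with m-min (proj₁ q N)
  ...   | inj₁ m<qN = ⊥-elim (asym m<qN (<-respʳ-≈ (p≈m N) qN<pN))
  ...   | inj₂ m≈qN = ⊥-elim (irrefl (Eq.sym m≈qN) (<-respʳ-≈ (p≈m N) qN<pN))

  eventually-minimum⇒hasMin : ∀ {m} → (∀ x → m < x ⊎ m ≈ x) →
                              Eventually (λ n → u n ≈ m) → HasMin
  eventually-minimum⇒hasMin {m} m-min (K , u≈m) =
    minimum , constant-minimum m-min minimum (λ _ → Eq.refl)
    where
    minimum : Class u
    minimum = (λ _ → m) , K , λ n K<n → Eq.sym (u≈m n K<n)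

  bound : Class u → ℕ
  bound p = proj₁ (proj₂ p)

  update : ℕ → Aᶜ → Seq
  update k x n with n ≟ℕ k
  ... | yes _ = x
  ... | no _ = u n

  update-at : ∀ k x → update k x k ≈ x
  update-at k x with k ≟ℕ k
  ... | yes _ = Eq.refl
  ... | no k≢k = ⊥-elim (k≢k refl)

  update-above : ∀ {k n} x → k <ℕ n → update k x n ≈ u n
  update-above {k} {n} x k<n with n ≟ℕ k
  ... | yes n≡k = ⊥-elim (>⇒≢ k<n n≡k)
  ... | no _ = Eq.refl

  updateᶜ : ℕ → Aᶜ → Class u
  updateᶜ k x = update k x , k , λ n → update-above x

  <L-update : ∀ (p : Class u) {k x} → bound p <ℕ k → u k < x → p <L updateᶜ k x
  <L-update (v , N , v∼u) {k} {x} N<k uk<x =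
    k , <-respʳ-≈ (Eq.sym (update-at k x)) (<-respˡ-≈ (Eq.sym (v∼u k N<k)) uk<x)
      , λ n k<n → Eq.trans (v∼u n (<-trans N<k k<n)) (Eq.sym (update-above x k<n))

  noMax×cofinalityΩ : InfinitelyOften (λ n → ∃[ x ] (u n < x)) → NoMax × CofinalityΩ
  noMax×cofinalityΩ io =
    (λ p → chain (bound p) , above p) , chain , increasing , λ p → bound p , inj₁ (above p)
    where
    index : ℕ → ℕ
    index zero = proj₁ (io zero)
    index (suc k) = proj₁ (io (index k))

    raise : ∀ k → ∃[ x ] (u (index k) < x)
    raise zero = proj₂ (proj₂ (io zero))
    raise (suc k) = proj₂ (proj₂ (io (index k)))

    index-increasing : ∀ k → index k <ℕ index (suc k)
    index-increasing k = proj₁ (proj₂ (io (index k)))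

    index-large : ∀ k → k <ℕ index k
    index-large zero = proj₁ (proj₂ (io zero))
    index-large (suc k) = ≤-<-trans (index-large k) (index-increasing k)

    chain : ℕ → Class u
    chain k = updateᶜ (index k) (proj₁ (raise k))

    increasing : ∀ k → chain k <L chain (suc k)
    increasing k = <L-update (chain k) (index-increasing k) (proj₂ (raise (suc k)))

    above : ∀ p → p <L chain (bound p)
    above p = <L-update p (index-large (bound p)) (proj₂ (raise (bound p)))

module Reversal {a ℓ₁ ℓ₂} (A : StrictTotalOrder a ℓ₁ ℓ₂) (u : LeftInfinite.Seq A) where
  open StrictTotalOrder A using (_<_; module Eq)
  open LeftInfinite A
  open OnClass u

  Aᵒᵖ : StrictTotalOrder a ℓ₁ ℓ₂
  Aᵒᵖ = Flip.strictTotalOrder A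

  module ᵒᵖ = LeftInfinite Aᵒᵖ
  module Cᵒᵖ = ᵒᵖ.OnClass u

  hasMax⇒hasMinᵒᵖ : OnA.HasMax → ᵒᵖ.OnA.HasMin
  hasMax⇒hasMinᵒᵖ (m , m-max) = m , λ x → Sum.map₂ Eq.sym (m-max x)

  <Lᵒᵖ⇒>L : ∀ p q → ᵒᵖ._<L_ {u} p q → q <L p
  <Lᵒᵖ⇒>L _ _ (N , lt , agree) = N , lt , λ n N<n → Eq.sym (agree n N<n)

  ≤ᵒᵖ⇒≥ : ∀ p q → Cᵒᵖ._≤_ p q → q ≤ p
  ≤ᵒᵖ⇒≥ p q (inj₁ p<q) = inj₁ (<Lᵒᵖ⇒>L p q p<q)
  ≤ᵒᵖ⇒≥ _ _ (inj₂ p≈q) = inj₂ λ n → Eq.sym (p≈q n)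

  noMaxᵒᵖ⇒noMin : Cᵒᵖ.NoMax → NoMin
  noMaxᵒᵖ⇒noMin noMax p = proj₁ (noMax p) , <Lᵒᵖ⇒>L p (proj₁ (noMax p)) (proj₂ (noMax p))

  noMinᵒᵖ⇒noMax : Cᵒᵖ.NoMin → NoMax
  noMinᵒᵖ⇒noMax noMin p = proj₁ (noMin p) , <Lᵒᵖ⇒>L (proj₁ (noMin p)) p (proj₂ (noMin p))

  hasMinᵒᵖ⇒hasMax : Cᵒᵖ.HasMin → HasMax
  hasMinᵒᵖ⇒hasMax (m , m-min) = m , λ p → ≤ᵒᵖ⇒≥ m p (m-min p)

  cofinalityΩᵒᵖ⇒coinitialityΩ : Cᵒᵖ.CofinalityΩ → CoinitialityΩ
  cofinalityΩᵒᵖ⇒coinitialityΩ (c , inc , cof) =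
    c , (λ n → <Lᵒᵖ⇒>L (c n) (c (suc n)) (inc n)) , λ p → proj₁ (cof p) , ≤ᵒᵖ⇒≥ p (c (proj₁ (cof p))) (proj₂ (cof p))

  coinitialityΩᵒᵖ⇒cofinalityΩ : Cᵒᵖ.CoinitialityΩ → CofinalityΩ
  coinitialityΩᵒᵖ⇒cofinalityΩ (c , dec , coi) =
    c , (λ n → <Lᵒᵖ⇒>L (c (suc n)) (c n) (dec n)) , λ p → proj₁ (coi p) , ≤ᵒᵖ⇒≥ (c (proj₁ (coi p))) p (proj₂ (coi p))

  zOrderᵒᵖ⇒zOrder : Cᵒᵖ.ZOrder → ZOrder
  zOrderᵒᵖ⇒zOrder (noMin , noMax , coi , cof) =
    noMaxᵒᵖ⇒noMin noMax , noMinᵒᵖ⇒noMax noMin ,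
    cofinalityΩᵒᵖ⇒coinitialityΩ cof , coinitialityΩᵒᵖ⇒cofinalityΩ coi

  noMin×coinitialityΩ : InfinitelyOften (λ n → ∃[ x ] (x < u n)) → NoMin × CoinitialityΩ
  noMin×coinitialityΩ io =
    noMaxᵒᵖ⇒noMin (proj₁ flipped) , cofinalityΩᵒᵖ⇒coinitialityΩ (proj₂ flipped)
    where
    flipped : Cᵒᵖ.NoMax × Cᵒᵖ.CofinalityΩ
    flipped = Lexicographic.noMax×cofinalityΩ Aᵒᵖ u io

module _ {a ℓ₁ ℓ₂} (A : StrictTotalOrder a ℓ₁ ℓ₂) (u : LeftInfinite.Seq A) where
  open StrictTotalOrder A
  open LeftInfinite A
  open OnClass u
  open Lexicographic A u using (noMax×cofinalityΩ; eventually-minimum⇒hasMin)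
  open Reversal A u using (noMin×coinitialityΩ)

  lowerable×raisable⇒zOrder : InfinitelyOften (λ n → ∃[ x ] (x < u n)) →
                              InfinitelyOften (λ n → ∃[ x ] (u n < x)) → ZOrder
  lowerable×raisable⇒zOrder lowerable raisable =
    proj₁ lower-end , proj₁ upper-end , proj₂ lower-end , proj₂ upper-end
    where
    lower-end : NoMin × CoinitialityΩ
    lower-end = noMin×coinitialityΩ lowerable
    upper-end : NoMax × CofinalityΩ
    upper-end = noMax×cofinalityΩ raisable

  noMin×noMax⇒zOrder : OnA.NoMin × OnA.NoMax → ZOrder
  noMin×noMax⇒zOrder (noMin , noMax) =
    lowerable×raisable⇒zOrder (everywhere⇒infinitelyOften (λ n → noMin (u n)))
                              (everywhere⇒infinitelyOften (λ n → noMax (u n)))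

  eventually⊎infinitelyOften-above : ExcludedMiddle ℓ₁ → ∀ {m} → (∀ x → m < x ⊎ m ≈ x) →
                                     Eventually (λ n → u n ≈ m) ⊎ InfinitelyOften (λ n → m < u n)
  eventually⊎infinitelyOften-above em {m} m-min with em {Eventually (λ n → u n ≈ m)}
  ... | yes ev = inj₁ ev
  ... | no ¬ev = inj₂ (infinitelyOften-map above-minimum (¬eventually⇒infinitelyOften¬ em ¬ev))
    where
    above-minimum : ∀ {n} → ¬ u n ≈ m → m < u n
    above-minimum {n} un≉m = Sum.[ id , (λ m≈un → ⊥-elim (un≉m (Eq.sym m≈un))) ] (m-min (u n))

  hasMin×noMax⇒ωOrder⊎zOrder : ExcludedMiddle (a ⊔ ℓ₁ ⊔ ℓ₂) →
                               OnA.HasMin × OnA.NoMax → ωOrder ⊎ ZOrder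
  hasMin×noMax⇒ωOrder⊎zOrder em ((m , m-min) , noMax) =
    Sum.map (λ ev → eventually-minimum⇒hasMin m-min ev , proj₂ (noMax×cofinalityΩ raisable))
            (λ above → lowerable×raisable⇒zOrder (infinitelyOften-map (m ,_) above) raisable)
            (eventually⊎infinitelyOften-above (excludedMiddle-lower (a ⊔ ℓ₂) em) m-min)
    where
    raisable : InfinitelyOften (λ n → ∃[ x ] (u n < x))
    raisable = everywhere⇒infinitelyOften (λ n → noMax (u n))

module _ {a ℓ₁ ℓ₂} (A : StrictTotalOrder a ℓ₁ ℓ₂) (u : LeftInfinite.Seq A) where
  open LeftInfinite A
  open OnClass u
  open Reversal A u

  hasMax×noMin⇒ω*Order⊎zOrder : ExcludedMiddle (a ⊔ ℓ₁ ⊔ ℓ₂) →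
                                OnA.HasMax × OnA.NoMin → ω*Order ⊎ ZOrder
  hasMax×noMin⇒ω*Order⊎zOrder em (hasMax , noMin) =
    Sum.map (Product.map hasMinᵒᵖ⇒hasMax cofinalityΩᵒᵖ⇒coinitialityΩ) zOrderᵒᵖ⇒zOrder
      (hasMin×noMax⇒ωOrder⊎zOrder Aᵒᵖ u em (hasMax⇒hasMinᵒᵖ hasMax , noMin))

lemma4p8 : ∀ {a ℓ₁ ℓ₂} (A : StrictTotalOrder a ℓ₁ ℓ₂) (u : LeftInfinite.Seq A) →
    ((LeftInfinite.OnA.NoMin A × LeftInfinite.OnA.NoMax A) →
       LeftInfinite.OnClass.ZOrder A u)
    × (ExcludedMiddle (a ⊔ ℓ₁ ⊔ ℓ₂) →
       (LeftInfinite.OnA.HasMin A × LeftInfinite.OnA.NoMax A) →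
       (LeftInfinite.OnClass.ωOrder A u ⊎ LeftInfinite.OnClass.ZOrder A u))
    × (ExcludedMiddle (a ⊔ ℓ₁ ⊔ ℓ₂) →
       (LeftInfinite.OnA.HasMax A × LeftInfinite.OnA.NoMin A) →
       (LeftInfinite.OnClass.ω*Order A u ⊎ LeftInfinite.OnClass.ZOrder A u))
lemma4p8 A u =
  noMin×noMax⇒zOrder A u , hasMin×noMax⇒ωOrder⊎zOrder A u , hasMax×noMin⇒ω*Order⊎zOrder A u
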